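{- Let $\mathbf{g}=\{g(n)\}_{n\geqslant 1}$ and $\mathbf{f}=\{f(n)\}_{n\geqslant 1}$ be the coefficient sequences defined by $$\sum_{n\geqslant 1}g(n)z^n=\sum_{k=0}^\infty\frac{z^{2^k}}{1-z^{2^k}},\qquad \sum_{n\geqslant 1}f(n)z^n=\sum_{k=0}^\infty\frac{z^{2^k}}{1+z^{2^k}}.$$ Then for every $n\geqslant 1$, the determinants of the Hankel matrices $H_n^1(\mathbf{g})=(g(i+j-1))_{1\leqslant i,j\leqslant n}$ and $H_n^1(\mathbf{f})=(f(i+j-1))_{1\leqslant i,j\leqslant n}$ are nonzero.
   Context: For a sequence $\mathbf{u}=\{u(j)\}$, the Hankel matrix is $H_n^p(\mathbf{u}):=(u(p+i+j-2))_{1\leqslant i,j\leqslant n}$. Note $g(n)$ equals the $2$-adic valuation of $2n$ (the ruler function). -}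

module Defs where

open import Data.Nat as ℕ using (ℕ; zero; suc)
open import Data.Nat.Divisibility using (_∣?_; divides)
open import Data.Integer as ℤ using (ℤ; +_; -_; _*_; _+_)
open import Data.Fin using (Fin; zero; suc; punchIn; toℕ)
open import Relation.Nullary using (yes; no)

sgn : ℕ → ℤ
sgn zero = + 1
sgn (suc k) = - sgn k

sumUpTo : ℕ → (ℕ → ℤ) → ℤ
sumUpTo zero t = t zero
sumUpTo (suc m) t = sumUpTo m t + t (suc m)

sumFin : (n : ℕ) → (Fin n → ℤ) → ℤ
sumFin zero t = + 0
sumFin (suc n) t = t zero + sumFin n (λ i → t (suc i))

-- Coefficient of z^n in z^{2^k}/(1 - z^{2^k}) = Σ_{m≥1} z^{m 2^k}: 1 if 2^k ∣ n (n ≥ 1), else 0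
coeffMinus : ℕ → ℕ → ℤ
coeffMinus n k with (2 ℕ.^ k) ∣? n
... | yes _ = + 1
... | no _ = + 0

-- Coefficient of z^n in z^{2^k}/(1 + z^{2^k}) = Σ_{m≥1} (-1)^{m-1} z^{m 2^k}
coeffPlus : ℕ → ℕ → ℤ
coeffPlus n k with (2 ℕ.^ k) ∣? n
... | yes (divides q _) = sgn (q ℕ.∸ 1)
... | no _ = + 0

-- g(n), f(n) for n ≥ 1: the sum over k ≥ 0 is finite, since 2^k ∣ n with n ≥ 1
-- forces 2^k ≤ n, hence k ≤ n; we truncate at k = n. (The value at n = 0 is never used.)
g : ℕ → ℤ
g n = sumUpTo n (coeffMinus n)

f : ℕ → ℤ
f n = sumUpTo n (coeffPlus n)

Matrix : ℕ → Set
Matrix n = Fin n → Fin n → ℤ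

det : (n : ℕ) → Matrix n → ℤ
det zero M = + 1
det (suc n) M = sumFin (suc n) (λ j → sgn (toℕ j) * (M zero j * det n (λ i k → M (suc i) (punchIn j k))))

-- Hankel matrix H_n^p(u) = (u(p+i+j-2))_{1≤i,j≤n}; with 0-indexed i,j this is u(p+i+j)
hankel : (n p : ℕ) → (ℕ → ℤ) → Matrix n
hankel n p u i j = u (p ℕ.+ toℕ i ℕ.+ toℕ j)

-- Everything is reduced modulo 2.  Modulo 2 the summands of f and g agree, and
-- c(r) = g(r + 1) mod 2 obeys c(2m) = 1, c(2m + 1) = 1 + c(m) (g(n) is the 2-adic
-- valuation of 2n).  The same recursion is satisfied by the moments c(r) = (Jʳ)₀₀ of the
-- symmetric tridiagonal matrix J over GF(2) with 1's off the diagonal and diagonal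
-- (0, 1, 1, …): writing Λ r = e₀ Jʳ, symmetry of J gives (J^{r+s})₀₀ = ⟨Λ r, Λ s⟩, and
-- the two recursions follow from two identities about rows of J.  Hence the Hankel matrix
-- (c(i + j)) is the Gram matrix Λ Λᵀ of the lower unitriangular matrix Λ, whose
-- determinant over GF(2) is 1.

module Submission where

open import Defs
open import Data.Nat using (ℕ; _≥_)
open import Data.Integer using (ℤ; +_)
open import Data.Product using (_×_; _,_)
open import Relation.Binary.PropositionalEquality using (_≢_)

open import Data.Bool.Base using (true; false; if_then_else_)
open import Data.Empty using (⊥-elim)
open import Data.Fin.Base using (Fin; toℕ; punchIn) renaming (zero to fzero; suc to fsuc)
open import Data.Integer.Base as ℤ using (-[1+_]; ∣_∣; _⊖_)
open import Data.Integer.Properties using (∣m⊖n∣≡∣n⊖m∣; ⊖-≥; [1+m]⊖[1+n]≡m⊖n; ∣-i∣≡∣i∣; ∣i*j∣≡∣i∣*∣j∣)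
open import Data.Maybe.Base using (just; nothing)
open import Data.Nat.Base as ℕ using (zero; suc; _<_; _≤_; z≤n; s≤s; parity)
open import Data.Nat.Divisibility using (_∣_; _∣?_; divides; 1∣_; ∣⇒≤; *-cancelˡ-∣; *-monoʳ-∣; ∣-trans; m∣m*n)
open import Data.Nat.Induction using (<-rec)
open import Data.Nat.Properties as ℕP using (≤-refl; ≤-trans; <-trans; m<n⇒m<1+n)
open import Data.Parity.Base using (Parity; 0ℙ; 1ℙ; _*_) renaming (_+_ to infixl 6 _+_)
open import Data.Parity.Properties as ℙP using (+-homo-+; *-homo-*; +-comm; +-assoc; +-identityʳ; *-zeroʳ)
open import Function.Base using (_∘_)
open import Relation.Binary.Definitions using (tri<; tri≈; tri>)
open import Relation.Binary.PropositionalEquality using (_≡_; refl; sym; trans; cong; cong₂; subst; module ≡-Reasoning)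
open import Relation.Nullary.Decidable using (yes; no; does; dec-true; dec-false)
open import Relation.Nullary.Negation using (¬_)
open import Tactic.RingSolver using (solve-∀)
open import Tactic.RingSolver.Core.AlmostCommutativeRing using (AlmostCommutativeRing; fromCommutativeRing)

GF2 : AlmostCommutativeRing _ _
GF2 = fromCommutativeRing ℙP.+-*-commutativeRing λ { 0ℙ → just refl ; 1ℙ → nothing }

+-interchange : ∀ a b c d → (a + b) + (c + d) ≡ (a + c) + (b + d)
+-interchange = solve-∀ GF2

∑ : ℕ → (ℕ → Parity) → Parity
∑ zero t = 0ℙ
∑ (suc n) t = t 0 + ∑ n (λ k → t (suc k))

syntax ∑ n (λ k → t) = ∑[ k < n ] t

∑-cong : ∀ n {s t : ℕ → Parity} → (∀ k → k < n → s k ≡ t k) → ∑ n s ≡ ∑ n t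
∑-cong zero eq = refl
∑-cong (suc n) eq = cong₂ _+_ (eq 0 (s≤s z≤n)) (∑-cong n (λ k k<n → eq (suc k) (s≤s k<n)))

∑-+ : ∀ n (s t : ℕ → Parity) → ∑[ k < n ] (s k + t k) ≡ ∑ n s + ∑ n t
∑-+ zero s t = refl
∑-+ (suc n) s t rewrite ∑-+ n (λ k → s (suc k)) (λ k → t (suc k)) = +-interchange (s 0) (t 0) _ _

∑-+₃ : ∀ n (s t w : ℕ → Parity) → ∑[ k < n ] (s k + t k + w k) ≡ ∑ n s + ∑ n t + ∑ n w
∑-+₃ n s t w = trans (∑-+ n (λ k → s k + t k) w) (cong (_+ ∑ n w) (∑-+ n s t))

∑-*ˡ : ∀ n w (t : ℕ → Parity) → w * ∑ n t ≡ ∑[ k < n ] (w * t k)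
∑-*ˡ zero w t = *-zeroʳ w
∑-*ˡ (suc n) w t = trans (ℙP.*-distribˡ-+ w (t 0) _) (cong (_+_ (w * t 0)) (∑-*ˡ n w (λ k → t (suc k))))

∑-zero : ∀ n (t : ℕ → Parity) → (∀ k → k < n → t k ≡ 0ℙ) → ∑ n t ≡ 0ℙ
∑-zero zero t eq = refl
∑-zero (suc n) t eq rewrite eq 0 (s≤s z≤n) = ∑-zero n _ (λ k k<n → eq (suc k) (s≤s k<n))

∑-snoc : ∀ n (t : ℕ → Parity) → ∑ (suc n) t ≡ ∑ n t + t n
∑-snoc zero t = +-comm (t 0) 0ℙ
∑-snoc (suc n) t = trans (cong (_+_ (t 0)) (∑-snoc n (λ k → t (suc k)))) (sym (+-assoc (t 0) _ _))

∑-drop-last : ∀ n (t : ℕ → Parity) → t n ≡ 0ℙ → ∑ (suc n) t ≡ ∑ n t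
∑-drop-last n t tn≡0 = trans (∑-snoc n t) (trans (cong (_+_ (∑ n t)) tn≡0) (+-identityʳ (∑ n t)))

VanishesFrom : ℕ → (ℕ → Parity) → Set
VanishesFrom a t = ∀ k → a ≤ k → t k ≡ 0ℙ

VanishesFrom-≤ : ∀ {a b} (t : ℕ → Parity) → a ≤ b → VanishesFrom a t → VanishesFrom b t
VanishesFrom-≤ t a≤b van k b≤k = van k (≤-trans a≤b b≤k)

∑-truncate : ∀ {a b} (t : ℕ → Parity) → a ≤ b → VanishesFrom a t → ∑ b t ≡ ∑ a t
∑-truncate {b = b} t z≤n van = ∑-zero b t (λ k _ → van k z≤n)
∑-truncate t (s≤s a≤b) van =
  cong (_+_ (t 0)) (∑-truncate (λ k → t (suc k)) a≤b (λ k a≤k → van (suc k) (s≤s a≤k)))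

∑-adjacent-pair : ∀ n c (t : ℕ → Parity) → suc c < n
                → (∀ k → k < n → k ≢ c → k ≢ suc c → t k ≡ 0ℙ) → t c ≡ t (suc c) → ∑ n t ≡ 0ℙ
∑-adjacent-pair (suc (suc n)) zero t _ off eq
  rewrite eq | ∑-zero n (λ k → t (suc (suc k))) (λ k k<n → off (suc (suc k)) (s≤s (s≤s k<n)) (λ ()) (λ ()))
  = trans (sym (+-assoc (t 1) (t 1) 0ℙ)) (trans (+-identityʳ _) (ℙP.p+p≡0ℙ (t 1)))
∑-adjacent-pair (suc n) (suc c) t (s≤s c<n) off eq rewrite off 0 (s≤s z≤n) (λ ()) (λ ()) =
  ∑-adjacent-pair n c (λ k → t (suc k)) c<n
    (λ k k<n k≢c k≢sc → off (suc k) (s≤s k<n) (k≢c ∘ ℕP.suc-injective) (k≢sc ∘ ℕP.suc-injective)) eq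

-- Square matrices over GF(2), indexed by ℕ; only the top-left n × n block matters for det₂ n.
Mat : Set
Mat = ℕ → ℕ → Parity

-- skip j enumerates ℕ ∖ {j} in increasing order (punchIn on ℕ).
skip : ℕ → ℕ → ℕ
skip zero k = suc k
skip (suc j) zero = zero
skip (suc j) (suc k) = suc (skip j k)

unskip : ℕ → ℕ → ℕ
unskip zero d = ℕ.pred d
unskip (suc j) zero = zero
unskip (suc j) (suc d) = suc (unskip j d)

minor : Mat → ℕ → Mat
minor M j i k = M (suc i) (skip j k)

-- The determinant over GF(2), by Laplace expansion along row 0 (signs disappear mod 2).
det₂ : ℕ → Mat → Parity
det₂ zero M = 1ℙ
det₂ (suc n) M = ∑[ j < suc n ] (M 0 j * det₂ n (minor M j))

skip-≢ : ∀ j k → skip j k ≢ j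
skip-≢ zero k ()
skip-≢ (suc j) zero ()
skip-≢ (suc j) (suc k) e = skip-≢ j k (ℕP.suc-injective e)

skip-injective : ∀ j {k l} → skip j k ≡ skip j l → k ≡ l
skip-injective zero e = ℕP.suc-injective e
skip-injective (suc j) {zero} {zero} e = refl
skip-injective (suc j) {suc k} {suc l} e = cong suc (skip-injective j (ℕP.suc-injective e))

skip-unskip : ∀ j d → j ≢ d → skip j (unskip j d) ≡ d
skip-unskip zero zero j≢d = ⊥-elim (j≢d refl)
skip-unskip zero (suc d) j≢d = refl
skip-unskip (suc j) zero j≢d = refl
skip-unskip (suc j) (suc d) j≢d = cong suc (skip-unskip j d (λ e → j≢d (cong suc e)))

skip-≤ : ∀ j k → skip j k ≤ suc k
skip-≤ zero k = ≤-refl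
skip-≤ (suc j) zero = z≤n
skip-≤ (suc j) (suc k) = s≤s (skip-≤ j k)

unskip-< : ∀ n j d → j < suc n → d < suc n → j ≢ d → unskip j d < n
unskip-< n zero zero _ _ j≢d = ⊥-elim (j≢d refl)
unskip-< n zero (suc d) _ (s≤s d<n) _ = d<n
unskip-< zero (suc j) d (s≤s ()) _ _
unskip-< (suc n) (suc j) zero _ _ _ = s≤s z≤n
unskip-< (suc n) (suc j) (suc d) (s≤s j<) (s≤s d<) j≢d = s≤s (unskip-< n j d j< d< (λ e → j≢d (cong suc e)))

unskip-suc : ∀ j c → j ≢ c → j ≢ suc c → unskip j (suc c) ≡ suc (unskip j c)
unskip-suc zero zero j≢c _ = ⊥-elim (j≢c refl)
unskip-suc zero (suc c) _ _ = refl
unskip-suc (suc zero) zero _ j≢sc = ⊥-elim (j≢sc refl)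
unskip-suc (suc (suc j)) zero _ _ = refl
unskip-suc (suc j) (suc c) j≢c j≢sc = cong suc (unskip-suc j c (j≢c ∘ cong suc) (j≢sc ∘ cong suc))

skip-adjacent : ∀ (v : ℕ → Parity) c → v c ≡ v (suc c) → ∀ k → v (skip c k) ≡ v (skip (suc c) k)
skip-adjacent v zero eq zero = sym eq
skip-adjacent v zero eq (suc k) = refl
skip-adjacent v (suc c) eq zero = refl
skip-adjacent v (suc c) eq (suc k) = skip-adjacent (λ x → v (suc x)) c eq k

det₂-cong : ∀ n {M N : Mat} → (∀ i k → k < n → M i k ≡ N i k) → det₂ n M ≡ det₂ n N
det₂-cong zero eq = refl
det₂-cong (suc n) eq = ∑-cong (suc n) λ j j<n →
  cong₂ _*_ (eq 0 j j<n)
    (det₂-cong n (λ i k k<n → eq (suc i) (skip j k) (≤-trans (s≤s (skip-≤ j k)) (s≤s k<n))))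

det₂-linear : ∀ n d w (M N P : Mat) → d < n
            → (∀ i k → k ≢ d → P i k ≡ M i k) → (∀ i k → k ≢ d → N i k ≡ M i k)
            → (∀ i → P i d ≡ M i d + w * N i d) → det₂ n P ≡ det₂ n M + w * det₂ n N
det₂-linear (suc n) d w M N P d<n P≈M N≈M P₀ = begin
    ∑[ j < suc n ] (P 0 j * det₂ n (minor P j))
  ≡⟨ ∑-cong (suc n) expand ⟩
    ∑[ j < suc n ] (M 0 j * det₂ n (minor M j) + w * (N 0 j * det₂ n (minor N j)))
  ≡⟨ ∑-+ (suc n) (λ j → M 0 j * det₂ n (minor M j)) (λ j → w * (N 0 j * det₂ n (minor N j))) ⟩
    det₂ (suc n) M + ∑[ j < suc n ] (w * (N 0 j * det₂ n (minor N j)))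
  ≡⟨ cong (_+_ (det₂ (suc n) M)) (sym (∑-*ˡ (suc n) w (λ j → N 0 j * det₂ n (minor N j)))) ⟩
    det₂ (suc n) M + w * det₂ (suc n) N
  ∎
  where
  open ≡-Reasoning
  distribʳ : ∀ a b w c → (a + w * b) * c ≡ a * c + w * (b * c)
  distribʳ = solve-∀ GF2
  distribˡ : ∀ a x y w → a * (x + w * y) ≡ a * x + w * (a * y)
  distribˡ = solve-∀ GF2
  expand : ∀ j → j < suc n → P 0 j * det₂ n (minor P j)
                             ≡ M 0 j * det₂ n (minor M j) + w * (N 0 j * det₂ n (minor N j))
  expand j j<n with j ℕP.≟ d
  ... | yes refl =
    let minorP≈minorM = det₂-cong n (λ i k _ → P≈M (suc i) (skip j k) (skip-≢ j k))
        minorN≈minorM = det₂-cong n (λ i k _ → N≈M (suc i) (skip j k) (skip-≢ j k))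
    in trans (cong₂ _*_ (P₀ 0) minorP≈minorM)
         (trans (distribʳ (M 0 j) (N 0 j) w _)
                (cong (λ x → M 0 j * det₂ n (minor M j) + w * (N 0 j * x)) (sym minorN≈minorM)))
  ... | no j≢d =
    let d′ = unskip j d
        skip-d′ = skip-unskip j d j≢d
        off : ∀ k → k ≢ d′ → skip j k ≢ d
        off k k≢d′ e = k≢d′ (skip-injective j (trans e (sym skip-d′)))
        minor-linear = det₂-linear n d′ w (minor M j) (minor N j) (minor P j) (unskip-< n j d j<n d<n j≢d)
          (λ i k k≢d′ → P≈M (suc i) (skip j k) (off k k≢d′))
          (λ i k k≢d′ → N≈M (suc i) (skip j k) (off k k≢d′))
          (λ i → subst (λ c → P (suc i) c ≡ M (suc i) c + w * N (suc i) c) (sym skip-d′) (P₀ (suc i)))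
    in trans (cong₂ _*_ (P≈M 0 j j≢d) minor-linear)
         (trans (distribˡ (M 0 j) _ _ w)
                (cong (λ x → M 0 j * det₂ n (minor M j) + w * (x * det₂ n (minor N j))) (sym (N≈M 0 j j≢d))))

det₂-adjacent-equal : ∀ n c (M : Mat) → suc c < n → (∀ i → M i c ≡ M i (suc c)) → det₂ n M ≡ 0ℙ
det₂-adjacent-equal (suc n) c M c<n eq = ∑-adjacent-pair (suc n) c _ c<n other-terms paired-terms
  where
  -- deleting a column other than c, c + 1 leaves two equal adjacent columns in the minor
  other-terms : ∀ j → j < suc n → j ≢ c → j ≢ suc c → M 0 j * det₂ n (minor M j) ≡ 0ℙ
  other-terms j j<n j≢c j≢sc = trans (cong (M 0 j *_) minor-zero) (*-zeroʳ (M 0 j))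
    where
    c′ = unskip j c
    at-c′ : skip j c′ ≡ c
    at-c′ = skip-unskip j c j≢c
    at-sc′ : skip j (suc c′) ≡ suc c
    at-sc′ = trans (cong (skip j) (sym (unskip-suc j c j≢c j≢sc))) (skip-unskip j (suc c) j≢sc)
    sc′<n : suc c′ < n
    sc′<n = subst (_< n) (unskip-suc j c j≢c j≢sc) (unskip-< n j (suc c) j<n c<n j≢sc)
    minor-zero : det₂ n (minor M j) ≡ 0ℙ
    minor-zero = det₂-adjacent-equal n c′ (minor M j) sc′<n
      (λ i → trans (cong (M (suc i)) at-c′) (trans (eq (suc i)) (cong (M (suc i)) (sym at-sc′))))
  paired-terms : M 0 c * det₂ n (minor M c) ≡ M 0 (suc c) * det₂ n (minor M (suc c))
  paired-terms = cong₂ _*_ (eq 0) (det₂-cong n (λ i k _ → skip-adjacent (M (suc i)) c (eq (suc i)) k))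

setCol : Mat → ℕ → (ℕ → Parity) → Mat
setCol M d v i k = if does (k ℕP.≟ d) then v i else M i k

setCol-on : ∀ M d v i → setCol M d v i d ≡ v i
setCol-on M d v i rewrite dec-true (d ℕP.≟ d) refl = refl

setCol-off : ∀ M d v i k → k ≢ d → setCol M d v i k ≡ M i k
setCol-off M d v i k k≢d rewrite dec-false (k ℕP.≟ d) k≢d = refl

setCol-≈ : ∀ (M P : Mat) d v → (∀ i k → k ≢ d → P i k ≡ M i k) → (∀ i → P i d ≡ v i)
         → ∀ i k → P i k ≡ setCol M d v i k
setCol-≈ M P d v off on i k with k ℕP.≟ d
... | yes refl = trans (on i) (sym (setCol-on M d v i))
... | no k≢d = trans (off i k k≢d) (sym (setCol-off M d v i k k≢d))

setCol₂ : Mat → ℕ → (ℕ → Parity) → (ℕ → Parity) → Mat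
setCol₂ M c u v = setCol (setCol M c u) (suc c) v

setCol₂-fst : ∀ M c u v i → setCol₂ M c u v i c ≡ u i
setCol₂-fst M c u v i = trans (setCol-off (setCol M c u) (suc c) v i c (ℕP.<⇒≢ (ℕP.n<1+n c))) (setCol-on M c u i)

setCol₂-snd : ∀ M c u v i → setCol₂ M c u v i (suc c) ≡ v i
setCol₂-snd M c u v i = setCol-on (setCol M c u) (suc c) v i

setCol₂-off : ∀ M c u v i k → k ≢ c → k ≢ suc c → setCol₂ M c u v i k ≡ M i k
setCol₂-off M c u v i k k≢c k≢sc = trans (setCol-off (setCol M c u) (suc c) v i k k≢sc) (setCol-off M c u i k k≢c)

setCol₂-off-fst : ∀ M c u u′ v i k → k ≢ c → setCol₂ M c u v i k ≡ setCol₂ M c u′ v i k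
setCol₂-off-fst M c u u′ v i k k≢c with does (k ℕP.≟ suc c)
... | true = refl
... | false = trans (setCol-off M c u i k k≢c) (sym (setCol-off M c u′ i k k≢c))

setCol₂-off-snd : ∀ M c u v v′ i k → k ≢ suc c → setCol₂ M c u v i k ≡ setCol₂ M c u v′ i k
setCol₂-off-snd M c u v v′ i k k≢sc rewrite dec-false (k ℕP.≟ suc c) k≢sc = refl

-- Over GF(2), det₂ is symmetric (not just alternating) in two adjacent columns:
-- expanding det(x + y, x + y) = 0 bilinearly leaves det(x, y) + det(y, x) = 0.
det₂-swap-adjacent : ∀ n c M u v → suc c < n → det₂ n (setCol₂ M c u v) ≡ det₂ n (setCol₂ M c v u)
det₂-swap-adjacent n c M u v c<n = sum-zero⇒equal (begin
    D u v + D v u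
  ≡⟨ sym (cong₂ _+_ (cong (_+ D u v) (D-diag u))
                    (trans (cong (_+_ (D v u)) (D-diag v)) (+-identityʳ (D v u)))) ⟩
    (D u u + D u v) + (D v u + D v v)
  ≡⟨ sym (trans (linear-fst u v (u ⊕ v)) (cong₂ _+_ (linear-snd u u v) (linear-snd v u v))) ⟩
    D (u ⊕ v) (u ⊕ v)
  ≡⟨ D-diag (u ⊕ v) ⟩
    0ℙ
  ∎)
  where
  open ≡-Reasoning
  c<n′ = <-trans (ℕP.n<1+n c) c<n
  _⊕_ : (ℕ → Parity) → (ℕ → Parity) → ℕ → Parity
  (x ⊕ y) i = x i + y i
  D : (ℕ → Parity) → (ℕ → Parity) → Parity
  D x y = det₂ n (setCol₂ M c x y)
  D-diag : ∀ x → D x x ≡ 0ℙ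
  D-diag x = det₂-adjacent-equal n c _ c<n (λ i → trans (setCol₂-fst M c x x i) (sym (setCol₂-snd M c x x i)))
  linear-fst : ∀ x y z → D (x ⊕ y) z ≡ D x z + D y z
  linear-fst x y z = det₂-linear n c 1ℙ _ _ _ c<n′
    (λ i k k≢c → setCol₂-off-fst M c (x ⊕ y) x z i k k≢c) (λ i k k≢c → setCol₂-off-fst M c y x z i k k≢c)
    (λ i → trans (setCol₂-fst M c (x ⊕ y) z i) (sym (cong₂ _+_ (setCol₂-fst M c x z i) (setCol₂-fst M c y z i))))
  linear-snd : ∀ x y z → D x (y ⊕ z) ≡ D x y + D x z
  linear-snd x y z = det₂-linear n (suc c) 1ℙ _ _ _ c<n
    (λ i k k≢sc → setCol₂-off-snd M c x (y ⊕ z) y i k k≢sc) (λ i k k≢sc → setCol₂-off-snd M c x z y i k k≢sc)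
    (λ i → trans (setCol₂-snd M c x (y ⊕ z) i) (sym (cong₂ _+_ (setCol₂-snd M c x y i) (setCol₂-snd M c x z i))))
  sum-zero⇒equal : ∀ {a b} → a + b ≡ 0ℙ → a ≡ b
  sum-zero⇒equal {0ℙ} {0ℙ} _ = refl
  sum-zero⇒equal {1ℙ} {1ℙ} _ = refl

swapCols : Mat → ℕ → Mat
swapCols M c = setCol₂ M c (λ i → M i (suc c)) (λ i → M i c)

det₂-swapCols : ∀ n c M → suc c < n → det₂ n (swapCols M c) ≡ det₂ n M
det₂-swapCols n c M c<n = trans (sym (det₂-swap-adjacent n c M (λ i → M i c) (λ i → M i (suc c)) c<n))
                                (sym (det₂-cong n (λ i k _ → M≈ i k)))
  where
  M≈ : ∀ i k → M i k ≡ setCol₂ M c (λ i → M i c) (λ i → M i (suc c)) i k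
  M≈ = setCol-≈ _ M (suc c) _ (λ i k _ → setCol-≈ M M c _ (λ _ _ _ → refl) (λ _ → refl) i k) (λ _ → refl)

-- det₂ is alternating: two equal columns c < d force det₂ = 0.  By adjacent swaps
-- column d is moved next to column c.
det₂-equal-columns : ∀ n c d (M : Mat) → c < d → d < n → (∀ i → M i c ≡ M i d) → det₂ n M ≡ 0ℙ
det₂-equal-columns n c (suc d) M c<sd sd<n eq with c ℕP.≟ d
... | yes refl = det₂-adjacent-equal n c M sd<n eq
... | no c≢d = trans (sym (det₂-swapCols n d M sd<n))
                     (det₂-equal-columns n c d (swapCols M d) c<d (<-trans (ℕP.n<1+n d) sd<n) eq′)
  where
  c<d : c < d
  c<d = ℕP.≤∧≢⇒< (ℕP.≤-pred c<sd) c≢d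
  eq′ : ∀ i → swapCols M d i c ≡ swapCols M d i d
  eq′ i = trans (setCol₂-off M d col-sd col-d i c c≢d (ℕP.<⇒≢ c<sd))
                (trans (eq i) (sym (setCol₂-fst M d col-sd col-d i)))
    where
    col-d col-sd : ℕ → Parity
    col-d i = M i d
    col-sd i = M i (suc d)

det₂-add-column : ∀ n d e w (M P : Mat) → d < n → e < n → e ≢ d
                → (∀ i k → k ≢ d → P i k ≡ M i k) → (∀ i → P i d ≡ M i d + w * M i e)
                → det₂ n P ≡ det₂ n M
det₂-add-column n d e w M P d<n e<n e≢d off on = begin
  det₂ n P              ≡⟨ det₂-linear n d w M N P d<n off (λ i k k≢d → setCol-off M d col-e i k k≢d)
                             (λ i → trans (on i) (cong (λ x → M i d + w * x) (sym (setCol-on M d col-e i)))) ⟩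
  det₂ n M + w * det₂ n N  ≡⟨ cong (λ x → det₂ n M + w * x) N-singular ⟩
  det₂ n M + w * 0ℙ     ≡⟨ cong (_+_ (det₂ n M)) (*-zeroʳ w) ⟩
  det₂ n M + 0ℙ         ≡⟨ +-identityʳ _ ⟩
  det₂ n M              ∎
  where
  open ≡-Reasoning
  col-e : ℕ → Parity
  col-e i = M i e
  N = setCol M d col-e
  N-twice : ∀ i → N i e ≡ N i d
  N-twice i = trans (setCol-off M d col-e i e e≢d) (sym (setCol-on M d col-e i))
  N-singular : det₂ n N ≡ 0ℙ
  N-singular with ℕP.<-cmp e d
  ... | tri< e<d _ _ = det₂-equal-columns n e d N e<d d<n N-twice
  ... | tri≈ _ e≡d _ = ⊥-elim (e≢d e≡d)
  ... | tri> _ _ d<e = det₂-equal-columns n d e N d<e e<n (λ i → sym (N-twice i))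

det₂-add-combination : ∀ n d (w : ℕ → Parity) (M P : Mat) → d < n
                     → (∀ i k → k ≢ d → P i k ≡ M i k)
                     → (∀ i → P i d ≡ M i d + ∑[ k < d ] (w k * M i k)) → det₂ n P ≡ det₂ n M
det₂-add-combination n d w M P d<n off on =
  trans (det₂-cong n (λ i k _ → setCol-≈ M P d (partial d) off on i k)) (partial-invariant d ≤-refl)
  where
  partial : ℕ → ℕ → Parity
  partial m i = M i d + ∑[ k < m ] (w k * M i k)
  partial-invariant : ∀ m → m ≤ d → det₂ n (setCol M d (partial m)) ≡ det₂ n M
  partial-invariant zero _ = det₂-cong n (λ i k _ →
    sym (setCol-≈ M M d (partial zero) (λ _ _ _ → refl) (λ i → sym (+-identityʳ (M i d))) i k))
  partial-invariant (suc m) m<d = trans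
    (det₂-add-column n d m (w m) (setCol M d (partial m)) (setCol M d (partial (suc m)))
       d<n (<-trans m<d d<n) (ℕP.<⇒≢ m<d)
       (λ i k k≢d → trans (setCol-off M d (partial (suc m)) i k k≢d) (sym (setCol-off M d (partial m) i k k≢d)))
       (λ i → begin
          setCol M d (partial (suc m)) i d
        ≡⟨ setCol-on M d (partial (suc m)) i ⟩
          M i d + ∑ (suc m) (λ k → w k * M i k)
        ≡⟨ cong (_+_ (M i d)) (∑-snoc m (λ k → w k * M i k)) ⟩
          M i d + (∑ m (λ k → w k * M i k) + w m * M i m)
        ≡⟨ sym (+-assoc (M i d) _ _) ⟩
          partial m i + w m * M i m
        ≡⟨ sym (cong₂ (λ x y → x + w m * y) (setCol-on M d (partial m) i)
                                             (setCol-off M d (partial m) i m (ℕP.<⇒≢ m<d))) ⟩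
          setCol M d (partial m) i d + w m * setCol M d (partial m) i m
        ∎))
    (partial-invariant m (ℕP.<⇒≤ m<d))
    where open ≡-Reasoning

record LowerUnitriangular (L : Mat) : Set where
  field
    above-zero : ∀ i k → i < k → L i k ≡ 0ℙ
    diagonal-one : ∀ i → L i i ≡ 1ℙ

open LowerUnitriangular

-- A lower unitriangular matrix has determinant 1: only the j = 0 term of the expansion survives.
det₂-unitriangular : ∀ n (L : Mat) → LowerUnitriangular L → det₂ n L ≡ 1ℙ
det₂-unitriangular zero L tri = refl
det₂-unitriangular (suc n) L tri =
  cong₂ _+_ (cong₂ _*_ (diagonal-one tri 0) (det₂-unitriangular n (minor L 0) minor-tri))
            (∑-zero n (λ j → L 0 (suc j) * det₂ n (minor L (suc j)))
                      (λ j _ → cong (_* det₂ n (minor L (suc j))) (above-zero tri 0 (suc j) (s≤s z≤n))))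
  where
  minor-tri : LowerUnitriangular (minor L 0)
  minor-tri = record { above-zero = λ i k i<k → above-zero tri (suc i) (suc k) (s≤s i<k)
                     ; diagonal-one = λ i → diagonal-one tri (suc i) }

-- The Gram matrix L Lᵀ of a lower triangular L; row s of L vanishes beyond column s,
-- so the sum defining (L Lᵀ) r s may stop at k = s.
gram : Mat → Mat
gram L r s = ∑[ k < suc s ] (L r k * L s k)

-- Column t of L Lᵀ is column t of L plus
-- ∑_{k<t} L t k · (column k of L), so replacing, for t = 0, 1, …, n - 1, column t of
-- L Lᵀ by column t of L never changes det₂, and ends at det₂ L = 1.
det₂-gram : ∀ n (L : Mat) → LowerUnitriangular L → det₂ n (gram L) ≡ 1ℙ
det₂-gram n L tri = begin
  det₂ n (gram L)    ≡⟨ det₂-cong n (λ i k _ → sym (hybrid-above 0 i k ℕP.n≮0)) ⟩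
  det₂ n (hybrid 0)  ≡⟨ hybrid-invariant n ≤-refl ⟩
  det₂ n (hybrid n)  ≡⟨ det₂-cong n (λ i k k<n → hybrid-below n i k k<n) ⟩
  det₂ n L           ≡⟨ det₂-unitriangular n L tri ⟩
  1ℙ                 ∎
  where
  open ≡-Reasoning
  hybrid : ℕ → Mat
  hybrid t i k = if does (k ℕP.<? t) then L i k else gram L i k
  hybrid-below : ∀ t i k → k < t → hybrid t i k ≡ L i k
  hybrid-below t i k k<t rewrite dec-true (k ℕP.<? t) k<t = refl
  hybrid-above : ∀ t i k → ¬ k < t → hybrid t i k ≡ gram L i k
  hybrid-above t i k k≮t rewrite dec-false (k ℕP.<? t) k≮t = refl
  hybrid-off : ∀ t i k → k ≢ t → hybrid t i k ≡ hybrid (suc t) i k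
  hybrid-off t i k k≢t with ℕP.<-cmp k t
  ... | tri< k<t _ _ = trans (hybrid-below t i k k<t) (sym (hybrid-below (suc t) i k (m<n⇒m<1+n k<t)))
  ... | tri≈ _ k≡t _ = ⊥-elim (k≢t k≡t)
  ... | tri> _ _ t<k = trans (hybrid-above t i k (ℕP.<⇒≯ t<k))
                             (sym (hybrid-above (suc t) i k (λ k<st → ℕP.<⇒≱ t<k (ℕP.≤-pred k<st))))
  hybrid-column : ∀ t i → hybrid t i t ≡ hybrid (suc t) i t + ∑[ k < t ] (L t k * hybrid (suc t) i k)
  hybrid-column t i = begin
      hybrid t i t
    ≡⟨ hybrid-above t i t (ℕP.<-irrefl refl) ⟩
      ∑ (suc t) (λ k → L i k * L t k)
    ≡⟨ ∑-snoc t (λ k → L i k * L t k) ⟩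
      ∑ t (λ k → L i k * L t k) + L i t * L t t
    ≡⟨ cong₂ _+_ (∑-cong t (λ k k<t → trans (ℙP.*-comm (L i k) (L t k))
                                          (cong (L t k *_) (sym (hybrid-below (suc t) i k (m<n⇒m<1+n k<t))))))
                 (trans (cong (L i t *_) (diagonal-one tri t)) (ℙP.*-identityʳ (L i t))) ⟩
      ∑ t (λ k → L t k * hybrid (suc t) i k) + L i t
    ≡⟨ +-comm _ (L i t) ⟩
      L i t + ∑ t (λ k → L t k * hybrid (suc t) i k)
    ≡⟨ cong (_+ ∑ t (λ k → L t k * hybrid (suc t) i k)) (sym (hybrid-below (suc t) i t ≤-refl)) ⟩
      hybrid (suc t) i t + ∑ t (λ k → L t k * hybrid (suc t) i k)
    ∎
  hybrid-invariant : ∀ t → t ≤ n → det₂ n (hybrid 0) ≡ det₂ n (hybrid t)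
  hybrid-invariant zero _ = refl
  hybrid-invariant (suc t) t<n = trans (hybrid-invariant t (ℕP.<⇒≤ t<n))
    (det₂-add-combination n t (L t) (hybrid (suc t)) (hybrid t) t<n (hybrid-off t) (hybrid-column t))

parityℤ : ℤ → Parity
parityℤ x = parity ∣ x ∣

parity-suc : ∀ m → parity (suc m) ≡ 1ℙ + parity m
parity-suc m = +-homo-+ 1 m

parity-suc₂ : ∀ m n → parity m + parity n ≡ parity (suc m) + parity (suc n)
parity-suc₂ m n rewrite parity-suc m | parity-suc n = flip₂ (parity m) (parity n)
  where
  flip₂ : ∀ a b → a + b ≡ (1ℙ + a) + (1ℙ + b)
  flip₂ 0ℙ 0ℙ = refl
  flip₂ 0ℙ 1ℙ = refl
  flip₂ 1ℙ 0ℙ = refl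
  flip₂ 1ℙ 1ℙ = refl

parity-⊖ : ∀ m n → parity ∣ m ⊖ n ∣ ≡ parity m + parity n
parity-⊖ zero n rewrite ∣m⊖n∣≡∣n⊖m∣ 0 n | ⊖-≥ (z≤n {n}) = refl
parity-⊖ (suc m) zero rewrite ⊖-≥ (z≤n {suc m}) = sym (+-identityʳ _)
parity-⊖ (suc m) (suc n) rewrite [1+m]⊖[1+n]≡m⊖n m n = trans (parity-⊖ m n) (parity-suc₂ m n)

parityℤ-+ : ∀ x y → parityℤ (x ℤ.+ y) ≡ parityℤ x + parityℤ y
parityℤ-+ -[1+ m ] -[1+ n ] = trans (+-homo-+ m n) (parity-suc₂ m n)
parityℤ-+ -[1+ m ] (+ n) = trans (parity-⊖ n (suc m)) (+-comm (parity n) _)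
parityℤ-+ (+ m) -[1+ n ] = parity-⊖ m (suc n)
parityℤ-+ (+ m) (+ n) = +-homo-+ m n

parityℤ-* : ∀ x y → parityℤ (x ℤ.* y) ≡ parityℤ x * parityℤ y
parityℤ-* x y = trans (cong parity (∣i*j∣≡∣i∣*∣j∣ x y)) (*-homo-* ∣ x ∣ ∣ y ∣)

parityℤ-sgn : ∀ k → parityℤ (sgn k) ≡ 1ℙ
parityℤ-sgn zero = refl
parityℤ-sgn (suc k) = trans (cong parity (∣-i∣≡∣i∣ (sgn k))) (parityℤ-sgn k)

parityℤ-sumFin : ∀ n (t : Fin n → ℤ) (u : ℕ → Parity) → (∀ j → parityℤ (t j) ≡ u (toℕ j))
               → parityℤ (sumFin n t) ≡ ∑ n u
parityℤ-sumFin zero t u eq = refl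
parityℤ-sumFin (suc n) t u eq = trans (parityℤ-+ (t fzero) _)
  (cong₂ _+_ (eq fzero) (parityℤ-sumFin n (λ j → t (fsuc j)) (λ k → u (suc k)) (λ j → eq (fsuc j))))

parityℤ-sumUpTo : ∀ m (t : ℕ → ℤ) → parityℤ (sumUpTo m t) ≡ ∑[ k < suc m ] parityℤ (t k)
parityℤ-sumUpTo zero t = sym (+-identityʳ _)
parityℤ-sumUpTo (suc m) t = begin
    parityℤ (sumUpTo m t ℤ.+ t (suc m))
  ≡⟨ parityℤ-+ (sumUpTo m t) (t (suc m)) ⟩
    parityℤ (sumUpTo m t) + parityℤ (t (suc m))
  ≡⟨ cong (_+ parityℤ (t (suc m))) (parityℤ-sumUpTo m t) ⟩
    ∑[ k < suc m ] parityℤ (t k) + parityℤ (t (suc m))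
  ≡⟨ sym (∑-snoc (suc m) (λ k → parityℤ (t k))) ⟩
    ∑[ k < suc (suc m) ] parityℤ (t k)
  ∎
  where open ≡-Reasoning

toℕ-punchIn : ∀ {n} (j : Fin (suc n)) (k : Fin n) → toℕ (punchIn j k) ≡ skip (toℕ j) (toℕ k)
toℕ-punchIn fzero k = refl
toℕ-punchIn (fsuc j) fzero = refl
toℕ-punchIn (fsuc j) (fsuc k) = cong suc (toℕ-punchIn j k)

parityℤ-det : ∀ n (M : Matrix n) (B : Mat) → (∀ i j → parityℤ (M i j) ≡ B (toℕ i) (toℕ j))
            → parityℤ (det n M) ≡ det₂ n B
parityℤ-det zero M B eq = refl
parityℤ-det (suc n) M B eq = parityℤ-sumFin (suc n) term (λ j → B 0 j * det₂ n (minor B j)) λ j → begin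
    parityℤ (sgn (toℕ j) ℤ.* (M fzero j ℤ.* det n (minorℤ j)))
  ≡⟨ parityℤ-* (sgn (toℕ j)) _ ⟩
    parityℤ (sgn (toℕ j)) * parityℤ (M fzero j ℤ.* det n (minorℤ j))
  ≡⟨ cong₂ _*_ (parityℤ-sgn (toℕ j)) (parityℤ-* (M fzero j) _) ⟩
    parityℤ (M fzero j) * parityℤ (det n (minorℤ j))
  ≡⟨ cong₂ _*_ (eq fzero j) (parityℤ-det n (minorℤ j) (minor B (toℕ j)) (minor-eq j)) ⟩
    B 0 (toℕ j) * det₂ n (minor B (toℕ j))
  ∎
  where
  open ≡-Reasoning
  minorℤ : Fin (suc n) → Matrix n
  minorℤ j i k = M (fsuc i) (punchIn j k)
  term : Fin (suc n) → ℤ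
  term j = sgn (toℕ j) ℤ.* (M fzero j ℤ.* det n (minorℤ j))
  minor-eq : ∀ j i k → parityℤ (minorℤ j i k) ≡ minor B (toℕ j) (toℕ i) (toℕ k)
  minor-eq j i k = trans (eq (fsuc i) (punchIn j k)) (cong (B (suc (toℕ i))) (toℕ-punchIn j k))

shiftRight : (ℕ → Parity) → ℕ → Parity
shiftRight u zero = 0ℙ
shiftRight u (suc k) = u k

diagonal : ℕ → Parity
diagonal zero = 0ℙ
diagonal (suc k) = 1ℙ

-- The row vector u J, where J is the symmetric tridiagonal matrix over GF(2) with
-- 1 on both off-diagonals and diagonal (0, 1, 1, …).
jacobi : (ℕ → Parity) → ℕ → Parity
jacobi u k = shiftRight u k + diagonal k * u k + u (suc k)

-- Λ r = e₀ Jʳ.  Its entries at k = 0 will turn out to be the parities of g(r + 1).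
Λ : ℕ → ℕ → Parity
Λ zero zero = 1ℙ
Λ zero (suc k) = 0ℙ
Λ (suc r) k = jacobi (Λ r) k

-- J is tridiagonal, so it widens the support of a row by one.
jacobi-vanishes : ∀ m u → VanishesFrom m u → VanishesFrom (suc m) (jacobi u)
jacobi-vanishes m u van (suc k) (s≤s m≤k)
  rewrite van k m≤k
        | van (suc k) (ℕP.m≤n⇒m≤1+n m≤k)
        | van (suc (suc k)) (ℕP.m≤n⇒m≤1+n (ℕP.m≤n⇒m≤1+n m≤k)) = refl

jacobi-top : ∀ m u → VanishesFrom (suc m) u → jacobi u (suc m) ≡ u m
jacobi-top m u van rewrite van (suc m) ≤-refl | van (suc (suc m)) (ℕP.n≤1+n (suc m)) =
  trans (+-identityʳ (u m + 0ℙ)) (+-identityʳ (u m))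

Λ-vanishes : ∀ r → VanishesFrom (suc r) (Λ r)
Λ-vanishes zero (suc k) _ = refl
Λ-vanishes (suc r) = jacobi-vanishes (suc r) (Λ r) (Λ-vanishes r)

-- The rows Λ r form a lower unitriangular matrix: J shifts the top entry one step right.
Λ-unitriangular : LowerUnitriangular Λ
Λ-unitriangular = record { above-zero = λ r k r<k → Λ-vanishes r k r<k ; diagonal-one = Λ-diagonal }
  where
  Λ-diagonal : ∀ r → Λ r r ≡ 1ℙ
  Λ-diagonal zero = refl
  Λ-diagonal (suc r) = trans (jacobi-top r (Λ r) (Λ-vanishes r)) (Λ-diagonal r)

jacobi-symmetric : ∀ m u v → VanishesFrom m u
                 → ∑[ k < suc m ] (jacobi u k * v k) ≡ ∑[ k < suc m ] (u k * jacobi v k)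
jacobi-symmetric m u v van = begin
    ∑[ k < suc m ] (jacobi u k * v k)
  ≡⟨ ∑-cong (suc m) (λ k _ → expandˡ (shiftRight u k) (diagonal k) (u k) (u (suc k)) (v k)) ⟩
    ∑[ k < suc m ] (shiftRight u k * v k + diagonal k * (u k * v k) + u (suc k) * v k)
  ≡⟨ ∑-+₃ (suc m) (λ k → shiftRight u k * v k) (λ k → diagonal k * (u k * v k))
                   (λ k → u (suc k) * v k) ⟩
    X + B + ∑[ k < suc m ] (u (suc k) * v k)
  ≡⟨ cong (_+_ (X + B)) (∑-drop-last m (λ k → u (suc k) * v k) (cong (_* v m) (van (suc m) (ℕP.n≤1+n m)))) ⟩
    X + B + Y
  ≡⟨ swap-ends X B Y ⟩
    Y + B + X
  ≡⟨ cong₂ (λ y x → y + B + x) (cong (_+ Y) (sym (*-zeroʳ (u 0))))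
                                (sym (∑-drop-last m (λ k → u k * v (suc k)) (cong (_* v (suc m)) (van m ≤-refl)))) ⟩
    ∑[ k < suc m ] (u k * shiftRight v k) + B + ∑[ k < suc m ] (u k * v (suc k))
  ≡⟨ sym (∑-+₃ (suc m) (λ k → u k * shiftRight v k) (λ k → diagonal k * (u k * v k))
                       (λ k → u k * v (suc k))) ⟩
    ∑[ k < suc m ] (u k * shiftRight v k + diagonal k * (u k * v k) + u k * v (suc k))
  ≡⟨ sym (∑-cong (suc m) (λ k _ → expandʳ (u k) (shiftRight v k) (diagonal k) (v k) (v (suc k)))) ⟩
    ∑[ k < suc m ] (u k * jacobi v k)
  ∎
  where
  open ≡-Reasoning
  X = ∑[ k < m ] (u k * v (suc k))
  Y = ∑[ k < m ] (u (suc k) * v k)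
  B = ∑[ k < suc m ] (diagonal k * (u k * v k))
  expandˡ : ∀ a d b c e → (a + d * b + c) * e ≡ a * e + d * (b * e) + c * e
  expandˡ = solve-∀ GF2
  expandʳ : ∀ b a d e c → b * (a + d * e + c) ≡ b * a + d * (b * e) + b * c
  expandʳ = solve-∀ GF2
  swap-ends : ∀ x b y → x + b + y ≡ y + b + x
  swap-ends = solve-∀ GF2

-- Every column of J sums to 1, so right multiplication by J preserves the sum of a row.
jacobi-sum : ∀ m u → VanishesFrom m u → ∑ (suc m) (jacobi u) ≡ ∑ m u
jacobi-sum m u van = begin
    ∑ (suc m) (jacobi u)
  ≡⟨ ∑-+₃ (suc m) (shiftRight u) (λ k → diagonal k * u k) (λ k → u (suc k)) ⟩
    ∑ m u + Z + ∑[ k < suc m ] u (suc k)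
  ≡⟨ cong (_+_ (∑ m u + Z)) (∑-drop-last m (λ k → u (suc k)) (van (suc m) (ℕP.n≤1+n m))) ⟩
    ∑ m u + Z + Z
  ≡⟨ ℙP.+-assoc (∑ m u) Z Z ⟩
    ∑ m u + (Z + Z)
  ≡⟨ cong (_+_ (∑ m u)) (ℙP.p+p≡0ℙ Z) ⟩
    ∑ m u + 0ℙ
  ≡⟨ +-identityʳ (∑ m u) ⟩
    ∑ m u
  ∎
  where
  open ≡-Reasoning
  Z = ∑[ k < m ] u (suc k)

-- The quadratic form of J: ⟨u, u J⟩ = ∑_{k ≥ 1} u k, since the off-diagonal terms come
-- in equal pairs and u k ² = u k.
jacobi-quadratic : ∀ m u → VanishesFrom m u → ∑[ k < suc m ] (u k * jacobi u k) ≡ ∑[ k < m ] u (suc k)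
jacobi-quadratic m u van = begin
    ∑[ k < suc m ] (u k * jacobi u k)
  ≡⟨ ∑-cong (suc m) (λ k _ → expand (u k) (shiftRight u k) (diagonal k) (u (suc k))) ⟩
    ∑[ k < suc m ] (u k * shiftRight u k + diagonal k * (u k * u k) + u k * u (suc k))
  ≡⟨ ∑-+₃ (suc m) (λ k → u k * shiftRight u k) (λ k → diagonal k * (u k * u k)) (λ k → u k * u (suc k)) ⟩
    (u 0 * 0ℙ + ∑[ k < m ] (u (suc k) * u k)) + ∑[ k < m ] (u (suc k) * u (suc k)) + ∑[ k < suc m ] (u k * u (suc k))
  ≡⟨ cong₃ (trans (cong (_+ ∑[ k < m ] (u (suc k) * u k)) (*-zeroʳ (u 0)))
                  (∑-cong m (λ k _ → ℙP.*-comm (u (suc k)) (u k))))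
           (∑-cong m (λ k _ → ℙP.*-idem (u (suc k))))
           (∑-drop-last m (λ k → u k * u (suc k)) (cong (_* u (suc m)) (van m ≤-refl))) ⟩
    W + Z + W
  ≡⟨ cancel W Z ⟩
    Z
  ∎
  where
  open ≡-Reasoning
  W = ∑[ k < m ] (u k * u (suc k))
  Z = ∑[ k < m ] u (suc k)
  expand : ∀ b a d c → b * (a + d * b + c) ≡ b * a + d * (b * b) + b * c
  expand = solve-∀ GF2
  cong₃ : ∀ {a a′ b b′ c c′} → a ≡ a′ → b ≡ b′ → c ≡ c′ → a + b + c ≡ a′ + b′ + c′
  cong₃ refl refl refl = refl
  cancel : ∀ w z → w + z + w ≡ z
  cancel 0ℙ z = +-identityʳ z
  cancel 1ℙ 0ℙ = refl
  cancel 1ℙ 1ℙ = refl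

-- The moments of J: Λ (r + s) 0 = ⟨e₀ Jʳ⁺ˢ, e₀⟩ = ⟨Λ r, Λ s⟩, by symmetry of J.
Λ-moment : ∀ r s N → r < N → Λ (r ℕ.+ s) 0 ≡ ∑[ k < N ] (Λ r k * Λ s k)
Λ-moment zero s (suc m) _ =
  sym (trans (cong (_+_ (Λ s 0)) (∑-zero m (λ k → 0ℙ) (λ _ _ → refl))) (+-identityʳ (Λ s 0)))
Λ-moment (suc r) s (suc m) (s≤s r<m) = begin
    Λ (suc r ℕ.+ s) 0
  ≡⟨ cong (λ t → Λ t 0) (sym (ℕP.+-suc r s)) ⟩
    Λ (r ℕ.+ suc s) 0
  ≡⟨ Λ-moment r (suc s) (suc m) (m<n⇒m<1+n r<m) ⟩
    ∑[ k < suc m ] (Λ r k * jacobi (Λ s) k)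
  ≡⟨ sym (jacobi-symmetric m (Λ r) (Λ s) (VanishesFrom-≤ (Λ r) r<m (Λ-vanishes r))) ⟩
    ∑[ k < suc m ] (jacobi (Λ r) k * Λ s k)
  ∎
  where open ≡-Reasoning

Λ-rowsum : ∀ r N → r < N → ∑ N (Λ r) ≡ 1ℙ
Λ-rowsum zero (suc m) _ = cong (_+_ 1ℙ) (∑-zero m (λ k → 0ℙ) (λ _ _ → refl))
Λ-rowsum (suc r) (suc m) (s≤s r<m) =
  trans (jacobi-sum m (Λ r) (VanishesFrom-≤ (Λ r) r<m (Λ-vanishes r))) (Λ-rowsum r m r<m)

-- The two halves of the recursion for the moments c(r) = Λ r 0:
-- c(2m) = ⟨Λ m, Λ m⟩ = ∑ Λ m = 1 and c(2m + 1) = ⟨Λ m, Λ m J⟩ = 1 + Λ m 0.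
Λ-even : ∀ m → Λ (m ℕ.+ m) 0 ≡ 1ℙ
Λ-even m = begin
  Λ (m ℕ.+ m) 0                      ≡⟨ Λ-moment m m (suc m) ≤-refl ⟩
  ∑[ k < suc m ] (Λ m k * Λ m k)     ≡⟨ ∑-cong (suc m) (λ k _ → ℙP.*-idem (Λ m k)) ⟩
  ∑ (suc m) (Λ m)                    ≡⟨ Λ-rowsum m (suc m) ≤-refl ⟩
  1ℙ                                 ∎
  where open ≡-Reasoning

Λ-odd : ∀ m → Λ (suc (m ℕ.+ m)) 0 ≡ 1ℙ + Λ m 0
Λ-odd m = begin
  Λ (suc (m ℕ.+ m)) 0                           ≡⟨ cong (λ t → Λ t 0) (sym (ℕP.+-suc m m)) ⟩
  Λ (m ℕ.+ suc m) 0                             ≡⟨ Λ-moment m (suc m) (suc (suc m)) (m<n⇒m<1+n ≤-refl) ⟩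
  ∑[ k < suc (suc m) ] (Λ m k * jacobi (Λ m) k) ≡⟨ jacobi-quadratic (suc m) (Λ m) (Λ-vanishes m) ⟩
  ∑[ k < suc m ] Λ m (suc k)                    ≡⟨ tail-sum ⟩
  1ℙ + Λ m 0                                    ∎
  where
  open ≡-Reasoning
  -- Λ m 0 + ∑_{k ≥ 1} Λ m k = 1
  tail-sum : ∑[ k < suc m ] Λ m (suc k) ≡ 1ℙ + Λ m 0
  tail-sum = solve-for (Λ m 0) _ (Λ-rowsum m (suc (suc m)) (m<n⇒m<1+n ≤-refl))
    where
    solve-for : ∀ a z → a + z ≡ 1ℙ → z ≡ 1ℙ + a
    solve-for 0ℙ z eq = eq
    solve-for 1ℙ 0ℙ eq = refl
    solve-for 1ℙ 1ℙ ()

data Half : ℕ → Set where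
  even : ∀ m → Half (m ℕ.+ m)
  odd : ∀ m → Half (suc (m ℕ.+ m))

half : ∀ r → Half r
half zero = even 0
half (suc r) with half r
... | even m = odd m
... | odd m = subst Half (cong suc (ℕP.+-suc m m)) (even (suc m))

-- The recursion c(2m) = 1, c(2m + 1) = 1 + c(m) satisfied both by the parities of
-- g(r + 1) and by Λ r 0; it determines c.
record RulerParity (c : ℕ → Parity) : Set where
  field
    at-even : ∀ m → c (m ℕ.+ m) ≡ 1ℙ
    at-odd : ∀ m → c (suc (m ℕ.+ m)) ≡ 1ℙ + c m

open RulerParity

RulerParity-unique : ∀ {a b} → RulerParity a → RulerParity b → ∀ r → a r ≡ b r
RulerParity-unique {a} {b} A B = <-rec (λ r → a r ≡ b r) step
  where
  step : ∀ r → (∀ {s} → s < r → a s ≡ b s) → a r ≡ b r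
  step r ih with half r
  ... | even m = trans (at-even A m) (sym (at-even B m))
  ... | odd m = trans (at-odd A m) (trans (cong (_+_ 1ℙ) (ih (s≤s (ℕP.m≤m+n m m)))) (sym (at-odd B m)))

Λ-RulerParity : RulerParity (λ r → Λ r 0)
Λ-RulerParity = record { at-even = Λ-even ; at-odd = Λ-odd }

divides-bit : ℕ → ℕ → Parity
divides-bit n k = parityℤ (coeffMinus n k)

-- The summands of f and g differ only by the signs ±1, which are odd.
coeffPlus-parity : ∀ n k → parityℤ (coeffPlus n k) ≡ divides-bit n k
coeffPlus-parity n k with (2 ℕ.^ k) ∣? n
... | yes (divides q _) = parityℤ-sgn (q ℕ.∸ 1)
... | no _ = refl

parityℤ-g : ∀ n → parityℤ (g n) ≡ ∑ (suc n) (divides-bit n)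
parityℤ-g n = parityℤ-sumUpTo n (coeffMinus n)

parityℤ-f : ∀ n → parityℤ (f n) ≡ parityℤ (g n)
parityℤ-f n = trans (parityℤ-sumUpTo n (coeffPlus n))
                    (trans (∑-cong (suc n) (λ k _ → coeffPlus-parity n k)) (sym (parityℤ-g n)))

divides-bit-zero : ∀ n → divides-bit n 0 ≡ 1ℙ
divides-bit-zero n with 1 ∣? n
... | yes _ = refl
... | no 1∤n = ⊥-elim (1∤n (1∣ n))

odd-not-even : ∀ m → ¬ (2 ∣ suc (m ℕ.+ m))
odd-not-even m (divides q eq) = 1ℙ≢0ℙ (begin
  1ℙ                                ≡⟨ sym (cong (_+_ 1ℙ) (ℙP.p+p≡0ℙ (parity m))) ⟩
  1ℙ + (parity m + parity m)        ≡⟨ sym (cong (_+_ 1ℙ) (+-homo-+ m m)) ⟩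
  1ℙ + parity (m ℕ.+ m)             ≡⟨ sym (parity-suc (m ℕ.+ m)) ⟩
  parity (suc (m ℕ.+ m))            ≡⟨ cong parity eq ⟩
  parity (q ℕ.* 2)                  ≡⟨ *-homo-* q 2 ⟩
  parity q * 0ℙ                     ≡⟨ *-zeroʳ (parity q) ⟩
  0ℙ                                ∎)
  where
  open ≡-Reasoning
  1ℙ≢0ℙ : 1ℙ ≢ 0ℙ
  1ℙ≢0ℙ ()

divides-bit-odd : ∀ m k → divides-bit (suc (m ℕ.+ m)) (suc k) ≡ 0ℙ
divides-bit-odd m k with (2 ℕ.^ suc k) ∣? suc (m ℕ.+ m)
... | yes 2^sk∣ = ⊥-elim (odd-not-even m (∣-trans (m∣m*n (2 ℕ.^ k)) 2^sk∣))
... | no _ = refl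

divides-bit-double : ∀ n k → divides-bit (n ℕ.+ n) (suc k) ≡ divides-bit n k
divides-bit-double n k with (2 ℕ.^ suc k) ∣? (n ℕ.+ n) | (2 ℕ.^ k) ∣? n
... | yes _ | yes _ = refl
... | no _ | no _ = refl
... | yes 2^sk∣2n | no 2^k∤n = ⊥-elim (2^k∤n (*-cancelˡ-∣ 2 (subst (2 ℕ.* 2 ℕ.^ k ∣_) n+n≡2n 2^sk∣2n)))
  where n+n≡2n = cong (n ℕ.+_) (sym (ℕP.+-identityʳ n))
... | no 2^sk∤2n | yes 2^k∣n = ⊥-elim (2^sk∤2n (subst (2 ℕ.* 2 ℕ.^ k ∣_) 2n≡n+n (*-monoʳ-∣ 2 2^k∣n)))
  where 2n≡n+n = cong (n ℕ.+_) (ℕP.+-identityʳ n)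

n<2^n : ∀ n → n < 2 ℕ.^ n
n<2^n zero = s≤s z≤n
n<2^n (suc n) = ≤-trans (ℕP.+-mono-≤ (ℕP.m^n>0 2 n) (n<2^n n))
                        (ℕP.≤-reflexive (cong (2 ℕ.^ n ℕ.+_) (sym (ℕP.+-identityʳ (2 ℕ.^ n)))))

divides-bit-vanishes : ∀ n → VanishesFrom (suc (suc n)) (divides-bit (suc n))
divides-bit-vanishes n k n<k with (2 ℕ.^ k) ∣? suc n
... | yes 2^k∣ = ⊥-elim (ℕP.<-asym n<k (ℕP.<-≤-trans (n<2^n k) (∣⇒≤ 2^k∣)))
... | no _ = refl

g-odd : ∀ m → parityℤ (g (suc (m ℕ.+ m))) ≡ 1ℙ
g-odd m = begin
    parityℤ (g N)
  ≡⟨ parityℤ-g N ⟩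
    divides-bit N 0 + ∑[ k < N ] divides-bit N (suc k)
  ≡⟨ cong₂ _+_ (divides-bit-zero N) (∑-zero N (λ k → divides-bit N (suc k)) (λ k _ → divides-bit-odd m k)) ⟩
    1ℙ
  ∎
  where
  open ≡-Reasoning
  N = suc (m ℕ.+ m)

g-double : ∀ n → parityℤ (g (suc n ℕ.+ suc n)) ≡ 1ℙ + parityℤ (g (suc n))
g-double n = begin
    parityℤ (g (N ℕ.+ N))
  ≡⟨ parityℤ-g (N ℕ.+ N) ⟩
    divides-bit (N ℕ.+ N) 0 + ∑[ k < N ℕ.+ N ] divides-bit (N ℕ.+ N) (suc k)
  ≡⟨ cong₂ _+_ (divides-bit-zero (N ℕ.+ N)) (∑-cong (N ℕ.+ N) (λ k _ → divides-bit-double N k)) ⟩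
    1ℙ + ∑ (N ℕ.+ N) (divides-bit N)
  ≡⟨ cong (_+_ 1ℙ) (∑-truncate (divides-bit N) (s≤s (ℕP.m≤n+m N n)) (divides-bit-vanishes n)) ⟩
    1ℙ + ∑ (suc N) (divides-bit N)
  ≡⟨ cong (_+_ 1ℙ) (sym (parityℤ-g N)) ⟩
    1ℙ + parityℤ (g N)
  ∎
  where
  open ≡-Reasoning
  N = suc n

g-RulerParity : RulerParity (λ r → parityℤ (g (suc r)))
g-RulerParity = record
  { at-even = g-odd
  ; at-odd = λ m → trans (cong (λ t → parityℤ (g (suc t))) (sym (ℕP.+-suc m m))) (g-double m)
  }

Λ-hankel-gram : ∀ r s → Λ (r ℕ.+ s) 0 ≡ gram Λ r s
Λ-hankel-gram r s = begin
  Λ (r ℕ.+ s) 0                    ≡⟨ cong (λ t → Λ t 0) (ℕP.+-comm r s) ⟩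
  Λ (s ℕ.+ r) 0                    ≡⟨ Λ-moment s r (suc s) ≤-refl ⟩
  ∑[ k < suc s ] (Λ s k * Λ r k)   ≡⟨ ∑-cong (suc s) (λ k _ → ℙP.*-comm (Λ s k) (Λ r k)) ⟩
  gram Λ r s                       ∎
  where open ≡-Reasoning

hankel-det-odd : ∀ n (u : ℕ → ℤ) → (∀ r → parityℤ (u (suc r)) ≡ Λ r 0)
               → parityℤ (det n (hankel n 1 u)) ≡ 1ℙ
hankel-det-odd n u u≡Λ = begin
  parityℤ (det n (hankel n 1 u))  ≡⟨ parityℤ-det n (hankel n 1 u) (gram Λ) entries ⟩
  det₂ n (gram Λ)                 ≡⟨ det₂-gram n Λ Λ-unitriangular ⟩
  1ℙ                              ∎
  where
  open ≡-Reasoning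
  entries : ∀ i j → parityℤ (hankel n 1 u i j) ≡ gram Λ (toℕ i) (toℕ j)
  entries i j = trans (u≡Λ (toℕ i ℕ.+ toℕ j)) (Λ-hankel-gram (toℕ i) (toℕ j))

odd⇒nonzero : ∀ {x} → parityℤ x ≡ 1ℙ → x ≢ + 0
odd⇒nonzero x-odd refl with x-odd
... | ()

theorem1p2 : (n : ℕ) → n ≥ 1 → (det n (hankel n 1 g) ≢ + 0) × (det n (hankel n 1 f) ≢ + 0)
theorem1p2 n _ = odd⇒nonzero (hankel-det-odd n g g≡Λ) , odd⇒nonzero (hankel-det-odd n f f≡Λ)
  where
  g≡Λ : ∀ r → parityℤ (g (suc r)) ≡ Λ r 0
  g≡Λ = RulerParity-unique g-RulerParity Λ-RulerParity
  f≡Λ : ∀ r → parityℤ (f (suc r)) ≡ Λ r 0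
  f≡Λ r = trans (parityℤ-f (suc r)) (g≡Λ r)
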